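{- Let $n\in\mathbb{N}$ with $n\neq 2$. Then the minimum of $\|\lambda\|_2^2$ over all partitions $\lambda$ of $n$ with $\operatorname{rank}(\lambda)\geq0$ is attained at a balanced partition, i.e., at a partition of rank $0$.
   Context: A partition of $n$ is a nonincreasing finite sequence $\lambda=(\lambda_1,\ldots,\lambda_k)$ of positive integers with sum $n$; $\|\lambda\|_2^2=\sum_i\lambda_i^2$; the rank of $\lambda$ is $\lambda_1-k$. A partition is balanced if its rank is $0$. -}

module Defs where

open import Data.Nat using (ℕ; zero; suc; _+_; _*_; _≥_; _>_)
open import Data.Integer using (ℤ; +_; _-_)
open import Data.List using (List; []; _∷_; map; length)
open import Data.Nat.ListAction using (sum)
open import Data.List.Relation.Unary.All using (All)
open import Data.List.Relation.Unary.Linked using (Linked)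
open import Data.Product using (_×_)
open import Relation.Binary.PropositionalEquality using (_≡_)

IsPartition : ℕ → List ℕ → Set
IsPartition n xs = Linked _≥_ xs × All (λ x → x > 0) xs × sum xs ≡ n

sqNorm : List ℕ → ℕ
sqNorm xs = sum (map (λ x → x * x) xs)

largest : List ℕ → ℕ
largest [] = 0
largest (x ∷ _) = x

rank : List ℕ → ℤ
rank xs = + largest xs - + length xs

{-# OPTIONS --safe #-}
module Submission where

-- Among partitions of n of nonnegative rank there is one, m, of least square norm, since there
-- are finitely many. While a partition has positive rank, a move lowers its rank without raising
-- the square norm: split a 1 off the last part of size ≥ 2 (lowering the rank by 1, or by 2 when
-- there is a single part), or, when λ₂ = 1, where that could overshoot, replace λ₁, 1 by
-- λ₁ - 1, 2. For n ≠ 2 the rank stays nonnegative, so iterating from m ends at a balanced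
-- partition whose square norm is at most that of m.

open import Defs
open import Data.Nat using (ℕ; zero; suc; _+_; _*_; _∸_; _≤_; _<_; _≥_; _>_; z≤n; s≤s; _≟_)
open import Data.Nat.Properties
open import Data.Nat.Induction using (<-wellFounded)
open import Data.Nat.ListAction using (sum)
open import Data.Nat.Tactic.RingSolver using (solve-∀)
open import Data.Integer using (+_) renaming (_≤_ to _≤ℤ_)
open import Data.Integer.Properties using (0≤i-j⇒j≤i; drop‿+≤+; +-inverseʳ)
open import Data.List using (List; []; _∷_; length; filter; upTo; cartesianProductWith)
open import Data.List.Relation.Unary.All as All using (All; []; _∷_; all?)
open import Data.List.Relation.Unary.All.Properties using (all-filter)
open import Data.List.Relation.Unary.Any using (here; there)
open import Data.List.Relation.Unary.Linked as Linked using (Linked; []; [-]; _∷_; linked?)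
open import Data.List.Membership.Propositional using (_∈_)
open import Data.List.Membership.Propositional.Properties
  using (∈-upTo⁺; ∈-cartesianProductWith⁺; ∈-filter⁺)
open import Data.List.Extrema.Nat using (argmin; argmin-all; f[argmin]≤f[xs])
open import Data.Product using (Σ; _×_; _,_)
open import Data.Empty using (⊥-elim)
open import Induction.WellFounded using (Acc; acc)
open import Relation.Nullary using (yes; no)
open import Relation.Nullary.Decidable using (_×-dec_)
open import Relation.Unary using (Decidable)
open import Relation.Binary.PropositionalEquality using (_≡_; _≢_; refl; sym; trans; cong; subst)

NonnegRankPartition : ℕ → List ℕ → Set
NonnegRankPartition n l = IsPartition n l × length l ≤ largest l

excess : List ℕ → ℕ
excess l = largest l ∸ length l

rank≥0⇒length≤largest : ∀ l → + 0 ≤ℤ rank l → length l ≤ largest l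
rank≥0⇒length≤largest l r = drop‿+≤+ (0≤i-j⇒j≤i r)

largest≡length⇒rank≡0 : ∀ l → largest l ≡ length l → rank l ≡ + 0
largest≡length⇒rank≡0 l eq rewrite eq = +-inverseʳ (+ length l)

nonnegRankPartition? : ∀ n → Decidable (NonnegRankPartition n)
nonnegRankPartition? n l =
  (linked? _≥?_ l ×-dec all? (0 <?_) l ×-dec sum l ≟ n) ×-dec length l ≤? largest l

oneRow : ℕ → List ℕ
oneRow zero = []
oneRow (suc n) = suc n ∷ []

oneRow-nonnegRank : ∀ n → NonnegRankPartition n (oneRow n)
oneRow-nonnegRank zero = ([] , [] , refl) , z≤n
oneRow-nonnegRank (suc n) = ([-] , s≤s z≤n ∷ [] , +-identityʳ (suc n)) , s≤s z≤n

boundedLists : ℕ → ℕ → List (List ℕ)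
boundedLists b zero = [] ∷ []
boundedLists b (suc k) = [] ∷ cartesianProductWith _∷_ (upTo b) (boundedLists b k)

∈-boundedLists : ∀ {b} k {l} → length l ≤ k → All (_< b) l → l ∈ boundedLists b k
∈-boundedLists zero {[]} _ _ = here refl
∈-boundedLists (suc k) {[]} _ _ = here refl
∈-boundedLists (suc k) {x ∷ l} (s≤s len≤k) (x<b ∷ l<b) =
  there (∈-cartesianProductWith⁺ _∷_ (∈-upTo⁺ x<b) (∈-boundedLists k len≤k l<b))

length≤sum : ∀ {l} → All (_> 0) l → length l ≤ sum l
length≤sum [] = z≤n
length≤sum (x>0 ∷ l>0) = +-mono-≤ x>0 (length≤sum l>0)

parts≤sum : ∀ l → All (_≤ sum l) l
parts≤sum [] = []
parts≤sum (x ∷ l) = m≤m+n x (sum l) ∷ All.map (λ y≤ → ≤-trans y≤ (m≤n+m (sum l) x)) (parts≤sum l)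

partition∈boundedLists : ∀ {n l} → IsPartition n l → l ∈ boundedLists (suc n) n
partition∈boundedLists {l = l} (_ , l>0 , refl) =
  ∈-boundedLists (sum l) (length≤sum l>0) (All.map s≤s (parts≤sum l))

module _ (n : ℕ) where

  minimizer : List ℕ
  minimizer = argmin sqNorm (oneRow n)
    (filter (nonnegRankPartition? n) (boundedLists (suc n) n))

  minimizer-nonnegRank : NonnegRankPartition n minimizer
  minimizer-nonnegRank =
    argmin-all sqNorm {P = NonnegRankPartition n} (oneRow-nonnegRank n)
      (all-filter (nonnegRankPartition? n) (boundedLists (suc n) n))

  minimizer-minimal : ∀ l → NonnegRankPartition n l → sqNorm minimizer ≤ sqNorm l
  minimizer-minimal l p@(pl , _) = All.lookup (f[argmin]≤f[xs] (oneRow n) _)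
    (∈-filter⁺ (nonnegRankPartition? n) (partition∈boundedLists pl) p)

sqNorm-split : ∀ a s → a * a + (1 + s) ≤ suc a * suc a + s
sqNorm-split a s = subst (a * a + (1 + s) ≤_) (sym (identity a s)) (m≤m+n _ (2 * a))
  where
  identity : ∀ a s → suc a * suc a + s ≡ a * a + (1 + s) + 2 * a
  identity = solve-∀

sqNorm-merge : ∀ a s → suc a * suc a + (4 + s) ≤ suc (suc a) * suc (suc a) + (1 + s)
sqNorm-merge a s = subst (suc a * suc a + (4 + s) ≤_) (sym (identity a s)) (m≤m+n _ (2 * a))
  where
  identity : ∀ a s → suc (suc a) * suc (suc a) + (1 + s) ≡ suc a * suc a + (4 + s) + 2 * a
  identity = solve-∀

-- breakOff x r splits a 1 off the last part ≥ 2 of the partition (2 + x) ∷ r; the head is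
-- passed as x so that it is ≥ 2 by construction.
breakOff : ℕ → List ℕ → List ℕ
breakOff x (suc (suc y) ∷ r) = 2 + x ∷ breakOff y r
breakOff x r = suc x ∷ 1 ∷ r

breakOff-length : ∀ x r → length (breakOff x r) ≡ 2 + length r
breakOff-length x [] = refl
breakOff-length x (0 ∷ r) = refl
breakOff-length x (1 ∷ r) = refl
breakOff-length x (suc (suc y) ∷ r) = cong suc (breakOff-length y r)

breakOff-sum : ∀ x r → sum (breakOff x r) ≡ sum (2 + x ∷ r)
breakOff-sum x [] = cong suc (+-suc x 0)
breakOff-sum x (0 ∷ r) = cong suc (+-suc x (sum r))
breakOff-sum x (1 ∷ r) = cong suc (+-suc x (suc (sum r)))
breakOff-sum x (suc (suc y) ∷ r) = cong (λ k → 2 + x + k) (breakOff-sum y r)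

breakOff-sqNorm : ∀ x r → sqNorm (breakOff x r) ≤ sqNorm (2 + x ∷ r)
breakOff-sqNorm x [] = sqNorm-split (suc x) 0
breakOff-sqNorm x (0 ∷ r) = sqNorm-split (suc x) _
breakOff-sqNorm x (1 ∷ r) = sqNorm-split (suc x) _
breakOff-sqNorm x (suc (suc y) ∷ r) = +-monoʳ-≤ (suc (suc x) * suc (suc x)) (breakOff-sqNorm y r)

breakOff-positive : ∀ x {r} → All (_> 0) r → All (_> 0) (breakOff x r)
breakOff-positive x {[]} [] = s≤s z≤n ∷ s≤s z≤n ∷ []
breakOff-positive x {0 ∷ r} (() ∷ _)
breakOff-positive x {1 ∷ r} r>0 = s≤s z≤n ∷ s≤s z≤n ∷ r>0
breakOff-positive x {suc (suc y) ∷ r} (_ ∷ r>0) = s≤s z≤n ∷ breakOff-positive y r>0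

breakOff-linked : ∀ {a} x r → a ≥ 2 + x → Linked _≥_ (2 + x ∷ r) → Linked _≥_ (a ∷ breakOff x r)
breakOff-linked x [] a≥ _ = ≤-trans (n≤1+n _) a≥ ∷ s≤s z≤n ∷ [-]
breakOff-linked x (0 ∷ r) a≥ (_ ∷ r↓) = ≤-trans (n≤1+n _) a≥ ∷ s≤s z≤n ∷ z≤n ∷ r↓
breakOff-linked x (1 ∷ r) a≥ (_ ∷ r↓) = ≤-trans (n≤1+n _) a≥ ∷ s≤s z≤n ∷ s≤s z≤n ∷ r↓
breakOff-linked x (suc (suc y) ∷ r) a≥ (h ∷ r↓) = a≥ ∷ breakOff-linked y r h r↓

breakOff-partition : ∀ {n} x r → IsPartition n (2 + x ∷ r) → IsPartition n (breakOff x r)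
breakOff-partition x r (l↓ , _ ∷ r>0 , s) =
  Linked.tail (breakOff-linked {2 + x} x r ≤-refl l↓) , breakOff-positive x r>0 ,
  trans (breakOff-sum x r) s

Improvement : ℕ → List ℕ → Set
Improvement n l = Σ (List ℕ) λ l' →
  NonnegRankPartition n l' × excess l' < excess l × sqNorm l' ≤ sqNorm l

improve : ∀ {n} → n ≢ 2 → ∀ l → IsPartition n l → length l < largest l → Improvement n l
improve n≢2 [] _ ()
improve n≢2 (0 ∷ t) _ ()
improve n≢2 (1 ∷ t) _ (s≤s ())
improve n≢2 (2 ∷ []) (_ , _ , s) _ = ⊥-elim (n≢2 (sym s))
improve n≢2 (2 ∷ _ ∷ _) _ (s≤s (s≤s ()))
improve n≢2 (suc (suc (suc c)) ∷ []) p _ =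
  breakOff (suc c) [] , (breakOff-partition (suc c) [] p , s≤s (s≤s z≤n)) ,
  m<n+m c (s≤s z≤n) , breakOff-sqNorm (suc c) []
improve n≢2 (suc (suc (suc c)) ∷ 0 ∷ t) (_ , _ ∷ () ∷ _ , _) _
improve {n} n≢2 (suc (suc (suc c)) ∷ 1 ∷ t) (_ ∷ 1↓ , _ ∷ _ ∷ t>0 , s) lt =
  (suc (suc c) ∷ 2 ∷ t) , (merged , ≤-pred lt) ,
  ∸-monoˡ-< (n<1+n _) (≤-pred lt) , sqNorm-merge (suc c) (sqNorm t)
  where
  raise : ∀ {t} → Linked _≥_ (1 ∷ t) → Linked _≥_ (2 ∷ t)
  raise [-] = [-]
  raise (h ∷ t↓) = ≤-trans h (n≤1+n 1) ∷ t↓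

  merged : IsPartition n (suc (suc c) ∷ 2 ∷ t)
  merged = s≤s (s≤s z≤n) ∷ raise 1↓ , s≤s z≤n ∷ s≤s z≤n ∷ t>0 ,
    trans (cong (λ k → 2 + k) (+-suc c (suc (sum t)))) s
improve n≢2 l@(suc (suc (suc c)) ∷ suc (suc y) ∷ t) p lt =
  breakOff (suc c) (suc (suc y) ∷ t) ,
  (breakOff-partition (suc c) (suc (suc y) ∷ t) p , subst (_≤ 3 + c) (sym len) lt) ,
  subst (λ k → 3 + c ∸ k < excess l) (sym len) (∸-monoʳ-< (n<1+n _) lt) ,
  breakOff-sqNorm (suc c) (suc (suc y) ∷ t)
  where
  len : suc (length (breakOff y t)) ≡ suc (length l)
  len = cong suc (breakOff-length y t)

BalancedBelow : ℕ → List ℕ → Set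
BalancedBelow n l = Σ (List ℕ) λ μ → IsPartition n μ × rank μ ≡ + 0 × sqNorm μ ≤ sqNorm l

balancedBelow : ∀ {n} → n ≢ 2 → ∀ l → NonnegRankPartition n l → BalancedBelow n l
balancedBelow {n} n≢2 l = go l (<-wellFounded (excess l))
  where
  go : ∀ l → Acc _<_ (excess l) → NonnegRankPartition n l → BalancedBelow n l
  go l (acc smaller) (pl , k≤L) with largest l ≟ length l
  ... | yes balanced = l , pl , largest≡length⇒rank≡0 l balanced , ≤-refl
  ... | no unbalanced with improve n≢2 l pl (≤∧≢⇒< k≤L (λ eq → unbalanced (sym eq)))
  ... | l' , pl' , excess< , l'≤l with go l' (smaller excess<) pl'
  ... | μ , pμ , rankμ , μ≤l' = μ , pμ , rankμ , ≤-trans μ≤l' l'≤l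

lemma11 : (n : ℕ) → n ≢ 2 →
    Σ (List ℕ) (λ μ → IsPartition n μ × rank μ ≡ + 0 ×
      ((l : List ℕ) → IsPartition n l → + 0 ≤ℤ rank l → sqNorm μ ≤ sqNorm l))
lemma11 n n≢2 with balancedBelow n≢2 (minimizer n) (minimizer-nonnegRank n)
... | μ , pμ , rankμ , μ≤min = μ , pμ , rankμ , λ l pl rank≥0 →
  ≤-trans μ≤min (minimizer-minimal n l (pl , rank≥0⇒length≤largest l rank≥0))
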